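{- Let $\Delta$ be a $(d-1)$-dimensional Boolean cell complex such that $h_i^\Delta \geq 0$ for $1 \leq i \leq d$. Then $h_i^{\mathrm{sd}(\Delta)} \geq h_i^\Delta$ for $0 \leq i \leq d$.
   Context: A Boolean cell complex is a regular CW-complex $\Delta$, regarded as the poset of its cells (faces) ordered by closure containment, with the empty cell included as least element, such that every lower interval $[\emptyset, A]$ is a Boolean lattice. For a $(d-1)$-dimensional Boolean cell complex, $f_{i}^\Delta$ ($-1 \le i \le d-1$) is the number of $i$-dimensional faces ($f_{ -1}^\Delta=1$), and the $h$-vector is defined by $\sum_{i=0}^d h_i^\Delta t^{d-i} = \sum_{i=0}^d f_{i-1}^\Delta (t-1)^{d-i}$. The barycentric subdivision $\mathrm{sd}(\Delta)$ is the simplicial complex whose vertices are the non-empty faces of $\Delta$ and whose faces are strictly increasing chains of non-empty faces. -}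

module Defs where

open import Level using (0ℓ)
open import Data.Nat as ℕ using (ℕ; zero; suc)
open import Data.Integer as ℤ using (ℤ; +_; -[1+_])
open import Data.Fin using (Fin)
open import Data.Fin.Properties using () renaming (_≟_ to _≟ᶠ_)
open import Data.Fin.Subset using (Subset; _⊆_)
open import Data.Vec using (Vec; []; _∷_)
open import Data.List using (List; []; _∷_; map; concatMap; filter; length; allFin)
open import Data.Product using (Σ; _×_; _,_; proj₁)
open import Relation.Binary using (Rel; IsPartialOrder; Decidable)
open import Relation.Binary.PropositionalEquality using (_≡_; _≢_)
open import Relation.Nullary using (Dec; yes; no; ¬_)
open import Relation.Nullary.Decidable using (_×-dec_; ¬?)
open import Data.Unit using (⊤; tt)

-- Boolean cell complexes, encoded by their face posets.
-- The faces (including the empty face ⊥) are the elements of Fin n,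
-- ordered by closure containment _≤_.  Every lower interval [⊥ , A]
-- is order-isomorphic to the Boolean lattice (Subset r , ⊆), where
-- r = rank A = dim A + 1 (the rank is part of the data, but it is
-- uniquely determined by the isomorphism).

Interval : {n : ℕ} → Rel (Fin n) 0ℓ → Fin n → Set
Interval {n} _≤_ A = Σ (Fin n) (λ B → B ≤ A)

record BooleanIso {n : ℕ} (_≤_ : Rel (Fin n) 0ℓ) (A : Fin n) (r : ℕ) : Set where
  field
    to       : Interval _≤_ A → Subset r
    from     : Subset r → Interval _≤_ A
    from-to  : ∀ B → proj₁ (from (to B)) ≡ proj₁ B
    to-from  : ∀ S → to (from S) ≡ S
    mono     : ∀ B C → proj₁ B ≤ proj₁ C → to B ⊆ to C
    mono⁻¹   : ∀ B C → to B ⊆ to C → proj₁ B ≤ proj₁ C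

record BooleanCellComplex (n : ℕ) : Set₁ where
  field
    _⊑_       : Rel (Fin n) 0ℓ
    _⊑?_      : Decidable _⊑_
    isPO      : IsPartialOrder _≡_ _⊑_
    ⊥         : Fin n
    ⊥-least   : ∀ A → ⊥ ⊑ A
    rank      : Fin n → ℕ              -- rank A = dim A + 1
    boolean   : ∀ A → BooleanIso _⊑_ A (rank A)

  _⊏_ : Rel (Fin n) 0ℓ
  A ⊏ B = (A ⊑ B) × (A ≢ B)

  _⊏?_ : Decidable _⊏_
  A ⊏? B = (A ⊑? B) ×-dec ¬? (A ≟ᶠ B)

open BooleanCellComplex public

-- Δ is (d-1)-dimensional: every face has rank ≤ d and some face has rank d
HasDim : {n : ℕ} → BooleanCellComplex n → ℕ → Set
HasDim {n} Δ d = (∀ A → rank Δ A ℕ.≤ d) × Σ (Fin n) (λ A → rank Δ A ≡ d)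

count : {A : Set} {P : A → Set} → (∀ x → Dec (P x)) → List A → ℕ
count P? xs = length (filter P? xs)

allVecs : (n k : ℕ) → List (Vec (Fin n) k)
allVecs n zero    = [] ∷ []
allVecs n (suc k) = concatMap (λ a → map (a ∷_) (allVecs n k)) (allFin n)

-- f-vector of Δ, shifted: fΔ Δ j = f_{j-1}^Δ  (so fΔ Δ 0 = f_{-1} = 1)
fΔ : {n : ℕ} → BooleanCellComplex n → ℕ → ℕ
fΔ Δ zero    = 1
fΔ {n} Δ (suc j) = count (λ A → rank Δ A ℕ.≟ suc j) (allFin n)

Increasing : {n k : ℕ} → BooleanCellComplex n → Vec (Fin n) k → Set
Increasing Δ []           = ⊤
Increasing Δ (a ∷ [])     = ⊤
Increasing Δ (a ∷ b ∷ v)  = _⊏_ Δ a b × Increasing Δ (b ∷ v)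

increasing? : {n k : ℕ} (Δ : BooleanCellComplex n) (v : Vec (Fin n) k) → Dec (Increasing Δ v)
increasing? Δ []          = yes tt
increasing? Δ (a ∷ [])    = yes tt
increasing? Δ (a ∷ b ∷ v) = _⊏?_ Δ a b ×-dec increasing? Δ (b ∷ v)

IsChain : {n k : ℕ} → BooleanCellComplex n → Vec (Fin n) (suc k) → Set
IsChain Δ (a ∷ v) = _⊏_ Δ (⊥ Δ) a × Increasing Δ (a ∷ v)

isChain? : {n k : ℕ} (Δ : BooleanCellComplex n) (v : Vec (Fin n) (suc k)) → Dec (IsChain Δ v)
isChain? Δ (a ∷ v) = _⊏?_ Δ (⊥ Δ) a ×-dec increasing? Δ (a ∷ v)

-- f-vector of the barycentric subdivision sd(Δ), shifted:
-- fsd Δ j = f_{j-1}^{sd Δ} = number of chains A₁ < … < A_j of non-empty faces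
fsd : {n : ℕ} → BooleanCellComplex n → ℕ → ℕ
fsd Δ zero = 1
fsd {n} Δ (suc j) = count (isChain? Δ) (allVecs n (suc j))

-- integer polynomials as coefficient lists (constant term first)

Poly : Set
Poly = List ℤ

_⊕_ : Poly → Poly → Poly
[] ⊕ q = q
(a ∷ p) ⊕ [] = a ∷ p
(a ∷ p) ⊕ (b ∷ q) = (a ℤ.+ b) ∷ (p ⊕ q)

scale : ℤ → Poly → Poly
scale c = map (c ℤ.*_)

_⊗_ : Poly → Poly → Poly
[] ⊗ q = []
(a ∷ p) ⊗ q = scale a q ⊕ (+ 0 ∷ (p ⊗ q))

_^ᵖ_ : Poly → ℕ → Poly
p ^ᵖ zero  = + 1 ∷ []
p ^ᵖ suc k = p ⊗ (p ^ᵖ k)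

t-1 : Poly
t-1 = -[1+ 0 ] ∷ + 1 ∷ []

coeff : Poly → ℕ → ℤ
coeff []      k       = + 0
coeff (a ∷ p) zero    = a
coeff (a ∷ p) (suc k) = coeff p k

Σ≤ : ℕ → (ℕ → Poly) → Poly
Σ≤ zero    g = g 0
Σ≤ (suc m) g = Σ≤ m g ⊕ g (suc m)

-- h-vector from a (shifted) f-vector f (f i = f_{i-1}) in dimension d-1:
--   Σ_{i=0}^d h_i t^{d-i} = Σ_{i=0}^d f_{i-1} (t-1)^{d-i},
-- so h_i is the coefficient of t^{d-i} of the right-hand side.
hVec : ℕ → (ℕ → ℕ) → ℕ → ℤ
hVec d f i = coeff (Σ≤ d (λ j → scale (+ f j) (t-1 ^ᵖ (d ℕ.∸ j)))) (d ℕ.∸ i)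

module Submission where

-- Grouping the chains A₁ ⊏ ⋯ ⊏ Aⱼ of sd(Δ) by their top face, whose lower interval is a Boolean
-- lattice of some rank m, gives f^{sd}_{j-1} = Σₘ f_{m-1} s(m, j), where s(m, j) counts the chains
-- ∅ ⊊ S₁ ⊊ ⋯ ⊊ Sⱼ = [m], i.e. the surjections [m] ↠ [j].  Reading the h-vector off
-- Σₘ f_{m-1} tᵐ (1-t)^{d-m} (the reversal of Σₘ f_{m-1} (t-1)^{d-m}), h^{sd} is therefore the image
-- of h under the linear map T sending tᵐ (1-t)^{d-m} to Σⱼ s(m, j) tʲ (1-t)^{d-j}.  Induction on d
-- (multiplying by 1 - t and summing by parts, the top case m = d being the binomial theorem) shows
-- that T sends tᵏ to the polynomial P_{d,k} defined by P_{0,0} = 1 and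
--   P_{d+1,k} = t · Σ_{j<k} P_{d,j} + Σ_{k≤j≤d} P_{d,j},
-- which has nonnegative coefficients and a positive coefficient of tᵏ.  Hence
-- h^{sd}_i = Σₖ hₖ [tⁱ] P_{d,k} ≥ hᵢ as soon as all hₖ ≥ 0 (h₀ = 1 holds always).

open import Level using (Level; 0ℓ)
open import Algebra.Bundles using (CommutativeSemiring)
open import Data.Bool using (Bool; true; false; not; _∧_)
open import Data.Fin using (Fin; zero; suc)
open import Data.Fin.Properties using (suc-injective) renaming (_≟_ to _≟ᶠ_)
open import Data.Fin.Subset using (Subset; inside; outside; _⊆_; ∣_∣)
open import Data.Fin.Subset.Properties using (_⊆?_; ⊆-antisym; ⊆-trans; ⊆-reflexive)
open import Data.Integer using (ℤ; +_; +≤+) renaming (_≤_ to _≤ℤ_; _*_ to _*ℤ_)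
import Data.Integer.Properties
open import Data.List using (List; []; _∷_; _++_; map; concatMap; filter; length; tabulate)
open import Data.List.Properties using (filter-++; length-++)
open import Data.Nat using (ℕ; zero; suc; _<_; _≤_; _≟_; z≤n; s≤s)
import Data.Nat.Properties as ℕ
open import Data.Nat.Logarithm using (⌊log₂_⌋; ⌊log₂[2^n]⌋≡n)
open import Data.Product using (_,_; proj₁; proj₂)
open import Data.Sum using (_⊎_; inj₁; inj₂)
open import Data.Vec as Vec using ([]; _∷_)
open import Function using (_∘_)
open import Function.Bundles using (_⇔_; mk⇔)
open import Relation.Binary using (Rel; Decidable; IsPartialOrder)
open import Relation.Binary.PropositionalEquality as ≡ using (_≡_; _≢_)
open import Relation.Nullary using (Dec; does; yes; no)
open import Relation.Nullary.Decidable using (dec-true; dec-false; does-⇔; _×-dec_)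
open import Relation.Nullary.Negation using (contradiction)
open import Defs
  using ( BooleanCellComplex; BooleanIso; Interval; HasDim; count; allVecs; increasing?; isChain?
        ; fΔ; fsd; Poly; _⊕_; scale; _⊗_; _^ᵖ_; t-1; coeff; Σ≤; hVec )

module RangeSums {c ℓ : Level} (R : CommutativeSemiring c ℓ) where

  open CommutativeSemiring R
  open import Algebra.Properties.CommutativeSemigroup +-commutativeSemigroup using (interchange)
  open import Relation.Binary.Reasoning.Setoid setoid

  Σ< : ℕ → (ℕ → Carrier) → Carrier
  Σ< zero    g = 0#
  Σ< (suc N) g = Σ< N g + g N

  𝟙 : Bool → Carrier
  𝟙 true  = 1#
  𝟙 false = 0#

  binomial : ℕ → ℕ → Carrier
  binomial n       zero    = 1#
  binomial zero    (suc k) = 0#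
  binomial (suc n) (suc k) = binomial n k + binomial n (suc k)

  t·_ : (ℕ → Carrier) → ℕ → Carrier
  (t· p) zero    = 0#
  (t· p) (suc i) = p i

  Σ<-cong : ∀ N {g h : ℕ → Carrier} → (∀ {j} → j < N → g j ≈ h j) → Σ< N g ≈ Σ< N h
  Σ<-cong zero    e = refl
  Σ<-cong (suc N) e = +-cong (Σ<-cong N (e ∘ ℕ.m<n⇒m<1+n)) (e (ℕ.n<1+n N))

  Σ<-zero : ∀ N {g : ℕ → Carrier} → (∀ {j} → j < N → g j ≈ 0#) → Σ< N g ≈ 0#
  Σ<-zero zero    e = refl
  Σ<-zero (suc N) e = trans (+-cong (Σ<-zero N (e ∘ ℕ.m<n⇒m<1+n)) (e (ℕ.n<1+n N))) (+-identityʳ 0#)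

  Σ<-distrib-+ : ∀ N (g h : ℕ → Carrier) → Σ< N (λ j → g j + h j) ≈ Σ< N g + Σ< N h
  Σ<-distrib-+ zero    g h = sym (+-identityʳ 0#)
  Σ<-distrib-+ (suc N) g h = trans (+-congʳ (Σ<-distrib-+ N g h)) (interchange _ _ _ _)

  *-distribˡ-Σ< : ∀ N x (g : ℕ → Carrier) → x * Σ< N g ≈ Σ< N (λ j → x * g j)
  *-distribˡ-Σ< zero    x g = zeroʳ x
  *-distribˡ-Σ< (suc N) x g = trans (distribˡ x _ _) (+-congʳ (*-distribˡ-Σ< N x g))

  *-distribʳ-Σ< : ∀ N x (g : ℕ → Carrier) → Σ< N g * x ≈ Σ< N (λ j → g j * x)
  *-distribʳ-Σ< zero    x g = zeroˡ x
  *-distribʳ-Σ< (suc N) x g = trans (distribʳ x _ _) (+-congʳ (*-distribʳ-Σ< N x g))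

  Σ<-comm : ∀ M K (h : ℕ → ℕ → Carrier) →
            Σ< M (λ a → Σ< K (h a)) ≈ Σ< K (λ b → Σ< M (λ a → h a b))
  Σ<-comm zero    K h = sym (Σ<-zero K (λ _ → refl))
  Σ<-comm (suc M) K h = trans (+-congʳ (Σ<-comm M K h)) (sym (Σ<-distrib-+ K _ (h M)))

  Σ<-head : ∀ N (g : ℕ → Carrier) → Σ< (suc N) g ≈ g 0 + Σ< N (g ∘ suc)
  Σ<-head zero    g = +-comm 0# (g 0)
  Σ<-head (suc N) g = trans (+-congʳ (Σ<-head N g)) (+-assoc _ _ _)

  𝟙-≟-*-≢ : ∀ {r m} x → r ≢ m → 𝟙 (does (r ≟ m)) * x ≈ 0#
  𝟙-≟-*-≢ {r} {m} x r≢m = trans (*-congʳ (reflexive (≡.cong 𝟙 (dec-false (r ≟ m) r≢m)))) (zeroˡ x)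

  Σ<-𝟙-≟ : ∀ N r (h : ℕ → Carrier) → r < N → Σ< N (λ m → 𝟙 (does (r ≟ m)) * h m) ≈ h r
  Σ<-𝟙-≟ zero r h ()
  Σ<-𝟙-≟ (suc N) r h r<1+N with ℕ.m≤n⇒m<n∨m≡n (ℕ.≤-pred r<1+N)
  ... | inj₁ r<N = trans (+-cong (Σ<-𝟙-≟ N r h r<N) (𝟙-≟-*-≢ (h N) (ℕ.<⇒≢ r<N))) (+-identityʳ (h r))
  ... | inj₂ ≡.refl =
    trans (+-cong (Σ<-zero r (λ {j} j<r → 𝟙-≟-*-≢ (h j) (ℕ.>⇒≢ j<r))) diagonal) (+-identityˡ (h r))
    where
    diagonal : 𝟙 (does (r ≟ r)) * h r ≈ h r
    diagonal = trans (*-congʳ (reflexive (≡.cong 𝟙 (dec-true (r ≟ r) ≡.refl)))) (*-identityˡ (h r))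

  binomial-zero : ∀ {n k} → n < k → binomial n k ≈ 0#
  binomial-zero {zero}  {suc k} _ = refl
  binomial-zero {suc n} {suc k} (s≤s n<k) =
    trans (+-cong (binomial-zero n<k) (binomial-zero (ℕ.m<n⇒m<1+n n<k))) (+-identityʳ 0#)

  binomial-diag : ∀ n → binomial n n ≈ 1#
  binomial-diag zero    = refl
  binomial-diag (suc n) =
    trans (+-cong (binomial-diag n) (binomial-zero (ℕ.n<1+n n))) (+-identityʳ 1#)

  Σ<-pascal : ∀ r M (g : ℕ → Carrier) →
    Σ< (suc M) (λ m → binomial (suc r) m * g m) ≈
    Σ< (suc M) (λ m → binomial r m * g m) + Σ< M (λ m → binomial r m * g (suc m))
  Σ<-pascal r zero    g = sym (+-identityʳ _)
  Σ<-pascal r (suc M) g = begin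
    Σ< (suc M) (λ m → binomial (suc r) m * g m) + (a + b) * x  ≈⟨ +-cong (Σ<-pascal r M g) (distribʳ x a b) ⟩
    (A + B) + (a * x + b * x)                                  ≈⟨ +-congˡ (+-comm _ _) ⟩
    (A + B) + (b * x + a * x)                                  ≈⟨ interchange A B (b * x) (a * x) ⟩
    (A + b * x) + (B + a * x)                                  ∎
    where
    A = Σ< (suc M) (λ m → binomial r m * g m)
    B = Σ< M (λ m → binomial r m * g (suc m))
    a = binomial r M
    b = binomial r (suc M)
    x = g (suc M)

  Σ<-t· : ∀ N (p : ℕ → ℕ → Carrier) i →
          Σ< N (λ j → (t· p j) i) ≈ (t· (λ i → Σ< N (λ j → p j i))) i
  Σ<-t· N p zero    = Σ<-zero N (λ _ → refl)
  Σ<-t· N p (suc i) = refl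

  Σ<-*-t· : ∀ N (c : ℕ → Carrier) (p : ℕ → ℕ → Carrier) i →
    Σ< N (λ j → c j * (t· p j) i) ≈ (t· (λ i → Σ< N (λ j → c j * p j i))) i
  Σ<-*-t· N c p zero    = Σ<-zero N (λ {j} _ → zeroʳ (c j))
  Σ<-*-t· N c p (suc i) = refl

  Σ<-*-Σ< : ∀ M K (a : ℕ → Carrier) (b : ℕ → ℕ → Carrier) (c : ℕ → Carrier) →
    Σ< M (λ m → a m * Σ< K (λ k → b m k * c k)) ≈ Σ< K (λ k → Σ< M (λ m → a m * b m k) * c k)
  Σ<-*-Σ< M K a b c = begin
    Σ< M (λ m → a m * Σ< K (λ k → b m k * c k))    ≈⟨ Σ<-cong M (λ {m} _ → *-distribˡ-Σ< K (a m) _) ⟩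
    Σ< M (λ m → Σ< K (λ k → a m * (b m k * c k)))  ≈⟨ Σ<-cong M (λ _ → Σ<-cong K (λ _ → sym (*-assoc _ _ _))) ⟩
    Σ< M (λ m → Σ< K (λ k → (a m * b m k) * c k))  ≈⟨ Σ<-comm M K _ ⟩
    Σ< K (λ k → Σ< M (λ m → (a m * b m k) * c k))  ≈⟨ Σ<-cong K (λ {k} _ → sym (*-distribʳ-Σ< M (c k) _)) ⟩
    Σ< K (λ k → Σ< M (λ m → a m * b m k) * c k)    ∎

module FaceCounting where

  open import Data.Nat using (_+_; _*_; _^_)
  open import Algebra.Properties.Semiring.Sum ℕ.+-*-semiring
    using (sum-syntax; sum-cong-≗; sum-replicate-zero; ∑-comm; ∑-distrib-+; *-distribˡ-sum; *-distribʳ-sum)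
  open RangeSums ℕ.+-*-commutativeSemiring
  open ≡ using (refl; sym; trans; cong; cong₂; subst)
  open ≡.≡-Reasoning

  module _ {A : Set} {P : A → Set} (P? : ∀ x → Dec (P x)) where

    count-++ : ∀ xs ys → count P? (xs ++ ys) ≡ count P? xs + count P? ys
    count-++ xs ys = trans (cong length (filter-++ P? xs ys)) (length-++ (filter P? xs))

    count-map : ∀ {B : Set} (f : B → A) xs → count P? (map f xs) ≡ count (P? ∘ f) xs
    count-map f []       = refl
    count-map f (x ∷ xs) with does (P? (f x))
    ... | true  = cong suc (count-map f xs)
    ... | false = count-map f xs

    count-tabulate : ∀ {n} (g : Fin n → A) →
                     count P? (tabulate g) ≡ ∑[ i < n ] 𝟙 (does (P? (g i)))
    count-tabulate {zero}  g = refl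
    count-tabulate {suc n} g with does (P? (g zero))
    ... | true  = cong suc (count-tabulate (g ∘ suc))
    ... | false = count-tabulate (g ∘ suc)

    count-concatMap-tabulate : ∀ {B : Set} {n} (f : B → List A) (g : Fin n → B) →
      count P? (concatMap f (tabulate g)) ≡ ∑[ i < n ] count P? (f (g i))
    count-concatMap-tabulate {n = zero}  f g = refl
    count-concatMap-tabulate {n = suc n} f g = trans (count-++ (f (g zero)) _)
      (cong (_+_ (count P? (f (g zero)))) (count-concatMap-tabulate f (g ∘ suc)))

  count-×-dec : ∀ {A Q : Set} {P : A → Set} (q? : Dec Q) (P? : ∀ x → Dec (P x)) xs →
    count (λ x → q? ×-dec P? x) xs ≡ 𝟙 (does q?) * count P? xs
  count-×-dec (yes q) P? xs = trans (count-yes xs) (sym (ℕ.*-identityˡ _))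
    where
    count-yes : ∀ xs → count (λ x → yes q ×-dec P? x) xs ≡ count P? xs
    count-yes []       = refl
    count-yes (x ∷ xs) with does (P? x)
    ... | true  = cong suc (count-yes xs)
    ... | false = count-yes xs
  count-×-dec (no _) P? []       = refl
  count-×-dec (no q) P? (x ∷ xs) = count-×-dec (no q) P? xs

  ∑-zero : ∀ {n} (g : Fin n → ℕ) → (∀ a → g a ≡ 0) → ∑[ a < n ] g a ≡ 0
  ∑-zero {n} g g≡0 = trans (sum-cong-≗ g≡0) (sum-replicate-zero n)

  ∑-single : ∀ {n} (g : Fin n → ℕ) x → (∀ a → a ≢ x → g a ≡ 0) → ∑[ a < n ] g a ≡ g x
  ∑-single {suc n} g zero    g≡0 = trans
    (cong (_+_ (g zero)) (∑-zero (g ∘ suc) (λ a → g≡0 (suc a) (λ ()))))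
    (ℕ.+-identityʳ (g zero))
  ∑-single {suc n} g (suc x) g≡0 = trans
    (cong (_+ ∑[ a < n ] g (suc a)) (g≡0 zero (λ ())))
    (∑-single (g ∘ suc) x (λ a a≢x → g≡0 (suc a) (a≢x ∘ suc-injective)))

  ∑-𝟙-≟ : ∀ {n} x (g : Fin n → ℕ) → ∑[ a < n ] (𝟙 (does (a ≟ᶠ x)) * g a) ≡ g x
  ∑-𝟙-≟ x g = trans
    (∑-single _ x (λ a a≢x → cong (λ b → 𝟙 b * g a) (dec-false (a ≟ᶠ x) a≢x)))
    (trans (cong (λ b → 𝟙 b * g x) (dec-true (x ≟ᶠ x) refl)) (ℕ.*-identityˡ (g x)))

  ∑-Σ<-comm : ∀ {n} N (h : Fin n → ℕ → ℕ) → ∑[ a < n ] Σ< N (h a) ≡ Σ< N (λ m → ∑[ a < n ] h a m)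
  ∑-Σ<-comm {n} zero    h = ∑-zero {n} (λ _ → 0) (λ _ → refl)
  ∑-Σ<-comm {n} (suc N) h = trans
    (∑-distrib-+ (λ a → Σ< N (h a)) (λ a → h a N))
    (cong (_+ ∑[ a < n ] h a N) (∑-Σ<-comm N h))

  ∑ˢ : ∀ r → (Subset r → ℕ) → ℕ
  ∑ˢ zero    g = g []
  ∑ˢ (suc r) g = ∑ˢ r (g ∘ (outside ∷_)) + ∑ˢ r (g ∘ (inside ∷_))

  ∑ˢ-cong : ∀ r {g h : Subset r → ℕ} → (∀ T → g T ≡ h T) → ∑ˢ r g ≡ ∑ˢ r h
  ∑ˢ-cong zero    g≡h = g≡h []
  ∑ˢ-cong (suc r) g≡h = cong₂ _+_ (∑ˢ-cong r (g≡h ∘ (outside ∷_))) (∑ˢ-cong r (g≡h ∘ (inside ∷_)))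

  ∑ˢ-zero : ∀ r {g : Subset r → ℕ} → (∀ T → g T ≡ 0) → ∑ˢ r g ≡ 0
  ∑ˢ-zero r g≡0 = trans (∑ˢ-cong r g≡0) (zeros r)
    where
    zeros : ∀ r → ∑ˢ r (λ _ → 0) ≡ 0
    zeros zero    = refl
    zeros (suc r) = cong₂ _+_ (zeros r) (zeros r)

  ∑ˢ-single : ∀ r (g : Subset r → ℕ) T₀ → (∀ T → T ≢ T₀ → g T ≡ 0) → ∑ˢ r g ≡ g T₀
  ∑ˢ-single zero    g []            _   = refl
  ∑ˢ-single (suc r) g (outside ∷ T₀) g≡0 =
    trans (cong₂ _+_ (∑ˢ-single r _ T₀ (λ T T≢T₀ → g≡0 _ (T≢T₀ ∘ cong Vec.tail)))
                         (∑ˢ-zero r (λ T → g≡0 _ (λ ()))))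
            (ℕ.+-identityʳ _)
  ∑ˢ-single (suc r) g (inside ∷ T₀)  g≡0 =
    cong₂ _+_ (∑ˢ-zero r (λ T → g≡0 _ (λ ())))
                (∑ˢ-single r _ T₀ (λ T T≢T₀ → g≡0 _ (T≢T₀ ∘ cong Vec.tail)))

  *-distribʳ-∑ˢ : ∀ r x (g : Subset r → ℕ) → ∑ˢ r g * x ≡ ∑ˢ r (λ T → g T * x)
  *-distribʳ-∑ˢ zero    x g = refl
  *-distribʳ-∑ˢ (suc r) x g = trans
    (ℕ.*-distribʳ-+ x (∑ˢ r (g ∘ (outside ∷_))) _)
    (cong₂ _+_ (*-distribʳ-∑ˢ r x _) (*-distribʳ-∑ˢ r x _))

  ∑-∑ˢ-comm : ∀ {n} r (h : Fin n → Subset r → ℕ) →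
              ∑[ a < n ] ∑ˢ r (h a) ≡ ∑ˢ r (λ T → ∑[ a < n ] h a T)
  ∑-∑ˢ-comm zero    h = refl
  ∑-∑ˢ-comm (suc r) h = trans
    (∑-distrib-+ (λ a → ∑ˢ r (h a ∘ (outside ∷_))) (λ a → ∑ˢ r (h a ∘ (inside ∷_))))
    (cong₂ _+_ (∑-∑ˢ-comm r (λ a → h a ∘ (outside ∷_))) (∑-∑ˢ-comm r (λ a → h a ∘ (inside ∷_))))

  ∑ˢ-1 : ∀ r → ∑ˢ r (λ _ → 1) ≡ 2 ^ r
  ∑ˢ-1 zero    = refl
  ∑ˢ-1 (suc r) = trans (cong₂ _+_ (∑ˢ-1 r) (∑ˢ-1 r)) (cong (_+_ (2 ^ r)) (sym (ℕ.+-identityʳ _)))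

  ∑ˢ-⊆ : ∀ r (S : Subset r) → ∑ˢ r (λ T → 𝟙 (does (T ⊆? S))) ≡ 2 ^ ∣ S ∣
  ∑ˢ-⊆ zero    []            = refl
  ∑ˢ-⊆ (suc r) (outside ∷ S) =
    trans (cong₂ _+_ (∑ˢ-⊆ r S) (∑ˢ-zero r (λ _ → refl))) (ℕ.+-identityʳ _)
  ∑ˢ-⊆ (suc r) (inside ∷ S)  =
    trans (cong₂ _+_ (∑ˢ-⊆ r S) (∑ˢ-⊆ r S)) (cong (_+_ (2 ^ ∣ S ∣)) (sym (ℕ.+-identityʳ _)))

  ∑ˢ-size : ∀ r (g : ℕ → ℕ) → ∑ˢ r (g ∘ ∣_∣) ≡ Σ< (suc r) (λ m → binomial r m * g m)
  ∑ˢ-size zero    g = sym (ℕ.+-identityʳ (g 0))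
  ∑ˢ-size (suc r) g = begin
    ∑ˢ r (g ∘ ∣_∣) + ∑ˢ r (g ∘ suc ∘ ∣_∣)
      ≡⟨ cong₂ _+_ (∑ˢ-size r g) (∑ˢ-size r (g ∘ suc)) ⟩
    A + B
      ≡⟨ cong (_+ B) (ℕ.+-identityʳ A) ⟨
    (A + 0) + B
      ≡⟨ cong (λ c → (A + c * g (suc r)) + B) (binomial-zero (ℕ.n<1+n r)) ⟨
    (A + binomial r (suc r) * g (suc r)) + B
      ≡⟨ Σ<-pascal r (suc r) g ⟨
    Σ< (suc (suc r)) (λ m → binomial (suc r) m * g m) ∎
    where
    A = Σ< (suc r) (λ m → binomial r m * g m)
    B = Σ< (suc r) (λ m → binomial r m * g (suc m))

  module Walks {n : ℕ} {_∼_ : Rel (Fin n) 0ℓ} (_∼?_ : Decidable _∼_) where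

    forward : (Fin n → ℕ) → Fin n → ℕ
    forward v a = ∑[ b < n ] (𝟙 (does (a ∼? b)) * v b)

    backward : (Fin n → ℕ) → Fin n → ℕ
    backward w b = ∑[ a < n ] (𝟙 (does (a ∼? b)) * w a)

    ∑-*-forward : ∀ w v → ∑[ a < n ] (w a * forward v a) ≡ ∑[ b < n ] (backward w b * v b)
    ∑-*-forward w v = begin
      ∑[ a < n ] (w a * forward v a)              ≡⟨ sum-cong-≗ (λ a → *-distribˡ-sum (w a) (λ b → e a b * v b)) ⟩
      ∑[ a < n ] ∑[ b < n ] (w a * (e a b * v b))  ≡⟨ ∑-comm (λ a b → w a * (e a b * v b)) ⟩
      ∑[ b < n ] ∑[ a < n ] (w a * (e a b * v b))  ≡⟨ sum-cong-≗ collect ⟩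
      ∑[ b < n ] (backward w b * v b)             ∎
      where
      e : Fin n → Fin n → ℕ
      e a b = 𝟙 (does (a ∼? b))
      collect : ∀ b → ∑[ a < n ] (w a * (e a b * v b)) ≡ backward w b * v b
      collect b = begin
        ∑[ a < n ] (w a * (e a b * v b))  ≡⟨ sum-cong-≗ (λ a → ℕ.*-assoc (w a) (e a b) (v b)) ⟨
        ∑[ a < n ] ((w a * e a b) * v b)  ≡⟨ sum-cong-≗ (λ a → cong (_* v b) (ℕ.*-comm (w a) (e a b))) ⟩
        ∑[ a < n ] ((e a b * w a) * v b)  ≡⟨ *-distribʳ-sum (v b) (λ a → e a b * w a) ⟨
        backward w b * v b               ∎

  surjections : ℕ → ℕ → ℕ
  surjections m       (suc k) = Σ< m (λ m′ → binomial m m′ * surjections m′ k)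
  surjections zero    zero    = 1
  surjections (suc m) zero    = 0

  surjections-zero : ∀ m k → m < k → surjections m k ≡ 0
  surjections-zero m (suc k) m<1+k = Σ<-zero m (λ {m′} m′<m → trans
    (cong (binomial m m′ *_) (surjections-zero m′ k (ℕ.<-≤-trans m′<m (ℕ.≤-pred m<1+k))))
    (ℕ.*-zeroʳ (binomial m m′)))

  2^-injective : ∀ {m n} → 2 ^ m ≡ 2 ^ n → m ≡ n
  2^-injective {m} {n} e = trans (sym (⌊log₂[2^n]⌋≡n m)) (trans (cong ⌊log₂_⌋ e) (⌊log₂[2^n]⌋≡n n))

  module Faces {n : ℕ} (Δ : BooleanCellComplex n) where

    open BooleanCellComplex Δ
    open IsPartialOrder isPO using (antisym)
      renaming (refl to ⊑-refl; trans to ⊑-trans; reflexive to ⊑-reflexive)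
    module Iso (b : Fin n) = BooleanIso (boolean b)

    from : ∀ b → Subset (rank b) → Fin n
    from b = proj₁ ∘ Iso.from b

    to-cong : ∀ b {B C : Interval _⊑_ b} → proj₁ B ≡ proj₁ C → Iso.to b B ≡ Iso.to b C
    to-cong b {B} {C} e =
      ⊆-antisym (Iso.mono b B C (⊑-reflexive e)) (Iso.mono b C B (⊑-reflexive (sym e)))

    ∑ˢ-𝟙-≟-from : ∀ b a → ∑ˢ (rank b) (λ T → 𝟙 (does (a ≟ᶠ from b T))) ≡ 𝟙 (does (a ⊑? b))
    ∑ˢ-𝟙-≟-from b a with a ⊑? b
    ... | yes a⊑b = trans (∑ˢ-single (rank b) _ S off)
                          (cong 𝟙 (dec-true (a ≟ᶠ from b S) (sym (Iso.from-to b (a , a⊑b)))))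
      where
      S = Iso.to b (a , a⊑b)
      off : ∀ T → T ≢ S → 𝟙 (does (a ≟ᶠ from b T)) ≡ 0
      off T T≢S = cong 𝟙 (dec-false (a ≟ᶠ from b T)
        (λ a≡ → T≢S (trans (sym (Iso.to-from b T)) (to-cong b (sym a≡)))))
    ... | no a⋢b = ∑ˢ-zero (rank b) (λ T → cong 𝟙 (dec-false (a ≟ᶠ from b T)
      (λ a≡ → a⋢b (subst (_⊑ b) (sym a≡) (proj₂ (Iso.from b T))))))

    ∑-⊑ : ∀ b (G : Fin n → ℕ) → ∑[ a < n ] (𝟙 (does (a ⊑? b)) * G a) ≡ ∑ˢ (rank b) (G ∘ from b)
    ∑-⊑ b G = begin
      ∑[ a < n ] (𝟙 (does (a ⊑? b)) * G a)      ≡⟨ sum-cong-≗ (λ a → cong (_* G a) (∑ˢ-𝟙-≟-from b a)) ⟨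
      ∑[ a < n ] (∑ˢ r (δ a) * G a)             ≡⟨ sum-cong-≗ (λ a → *-distribʳ-∑ˢ r (G a) (δ a)) ⟩
      ∑[ a < n ] ∑ˢ r (λ T → δ a T * G a)       ≡⟨ ∑-∑ˢ-comm r (λ a T → δ a T * G a) ⟩
      ∑ˢ r (λ T → ∑[ a < n ] (δ a T * G a))     ≡⟨ ∑ˢ-cong r (λ T → ∑-𝟙-≟ (from b T) G) ⟩
      ∑ˢ r (G ∘ from b)                        ∎
      where
      r = rank b
      δ : Fin n → Subset r → ℕ
      δ a T = 𝟙 (does (a ≟ᶠ from b T))

    ∑-⊑-1 : ∀ b → ∑[ a < n ] 𝟙 (does (a ⊑? b)) ≡ 2 ^ rank b
    ∑-⊑-1 b = trans (sum-cong-≗ (λ a → sym (ℕ.*-identityʳ (𝟙 (does (a ⊑? b))))))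
                    (trans (∑-⊑ b (λ _ → 1)) (∑ˢ-1 (rank b)))

    rank-⊥ : rank ⊥ ≡ 0
    rank-⊥ = 2^-injective (trans (sym (∑-⊑-1 ⊥))
                                 (trans (∑-single _ ⊥ off) (cong 𝟙 (dec-true (⊥ ⊑? ⊥) ⊑-refl))))
      where
      off : ∀ a → a ≢ ⊥ → 𝟙 (does (a ⊑? ⊥)) ≡ 0
      off a a≢⊥ = cong 𝟙 (dec-false (a ⊑? ⊥) (λ a⊑⊥ → a≢⊥ (antisym a⊑⊥ (⊥-least a))))

    rank≡0⇒≡⊥ : ∀ b → rank b ≡ 0 → b ≡ ⊥
    rank≡0⇒≡⊥ b r≡0 = trans (sym (Iso.from-to b (b , ⊑-refl)))
      (trans (cong (from b) (unique r≡0 _ _)) (Iso.from-to b (⊥ , ⊥-least b)))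
      where
      unique : ∀ {r} → r ≡ 0 → (S T : Subset r) → S ≡ T
      unique refl [] [] = refl

    rank-⊑ : ∀ b a (a⊑b : a ⊑ b) → rank a ≡ ∣ Iso.to b (a , a⊑b) ∣
    rank-⊑ b a a⊑b = 2^-injective (begin
      2 ^ rank a                                          ≡⟨ ∑-⊑-1 a ⟨
      ∑[ c < n ] 𝟙 (does (c ⊑? a))                        ≡⟨ sum-cong-≗ below-a ⟩
      ∑[ c < n ] (𝟙 (does (c ⊑? b)) * 𝟙 (does (c ⊑? a)))  ≡⟨ ∑-⊑ b (λ c → 𝟙 (does (c ⊑? a))) ⟩
      ∑ˢ (rank b) (λ T → 𝟙 (does (from b T ⊑? a)))        ≡⟨ ∑ˢ-cong (rank b) below-a⇔⊆S ⟩
      ∑ˢ (rank b) (λ T → 𝟙 (does (T ⊆? S)))               ≡⟨ ∑ˢ-⊆ (rank b) S ⟩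
      2 ^ ∣ S ∣                                           ∎)
      where
      S = Iso.to b (a , a⊑b)
      below-a : ∀ c → 𝟙 (does (c ⊑? a)) ≡ 𝟙 (does (c ⊑? b)) * 𝟙 (does (c ⊑? a))
      below-a c with c ⊑? a
      ... | yes c⊑a = cong (λ x → 𝟙 x * 1) (sym (dec-true (c ⊑? b) (⊑-trans c⊑a a⊑b)))
      ... | no _    = sym (ℕ.*-zeroʳ (𝟙 (does (c ⊑? b))))
      ⊑a⇒⊆S : ∀ T → from b T ⊑ a → T ⊆ S
      ⊑a⇒⊆S T T⊑a =
        ⊆-trans (⊆-reflexive (sym (Iso.to-from b T))) (Iso.mono b (Iso.from b T) (a , a⊑b) T⊑a)
      ⊆S⇒⊑a : ∀ T → T ⊆ S → from b T ⊑ a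
      ⊆S⇒⊑a T T⊆S =
        Iso.mono⁻¹ b (Iso.from b T) (a , a⊑b) (⊆-trans (⊆-reflexive (Iso.to-from b T)) T⊆S)
      below-a⇔⊆S : ∀ T → 𝟙 (does (from b T ⊑? a)) ≡ 𝟙 (does (T ⊆? S))
      below-a⇔⊆S T = cong 𝟙 (does-⇔ (mk⇔ (⊑a⇒⊆S T) (⊆S⇒⊑a T)) (from b T ⊑? a) (T ⊆? S))

    rank-from : ∀ b T → rank (from b T) ≡ ∣ T ∣
    rank-from b T = trans (rank-⊑ b _ (proj₂ (Iso.from b T))) (cong ∣_∣ (Iso.to-from b T))

    ∑-⊑-split : ∀ b (G : Fin n → ℕ) →
      ∑[ a < n ] (𝟙 (does (a ⊑? b)) * G a) ≡ ∑[ a < n ] (𝟙 (does (a ⊏? b)) * G a) + G b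
    ∑-⊑-split b G = begin
      ∑[ a < n ] (𝟙 (does (a ⊑? b)) * G a)                          ≡⟨ sum-cong-≗ split ⟩
      ∑[ a < n ] (𝟙 (does (a ⊏? b)) * G a + 𝟙 (does (a ≟ᶠ b)) * G a)  ≡⟨ ∑-distrib-+ (λ a → 𝟙 (does (a ⊏? b)) * G a) _ ⟩
      S + ∑[ a < n ] (𝟙 (does (a ≟ᶠ b)) * G a)                       ≡⟨ cong (_+_ S) (∑-𝟙-≟ b G) ⟩
      S + G b                                                       ∎
      where
      S = ∑[ a < n ] (𝟙 (does (a ⊏? b)) * G a)
      split : ∀ a → 𝟙 (does (a ⊑? b)) * G a ≡
                    𝟙 (does (a ⊑? b) ∧ not (does (a ≟ᶠ b))) * G a + 𝟙 (does (a ≟ᶠ b)) * G a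
      split a with a ⊑? b | a ≟ᶠ b
      ... | yes _   | yes _     = refl
      ... | yes _   | no _      = sym (ℕ.+-identityʳ _)
      ... | no a⋢a  | yes refl = contradiction ⊑-refl a⋢a
      ... | no _    | no _      = refl

    ∑-⊏ : ∀ b (g : ℕ → ℕ) →
          ∑[ a < n ] (𝟙 (does (a ⊏? b)) * g (rank a)) ≡ Σ< (rank b) (λ m → binomial (rank b) m * g m)
    ∑-⊏ b g = ℕ.+-cancelʳ-≡ (g r) _ _ (begin
      ∑[ a < n ] (𝟙 (does (a ⊏? b)) * g (rank a)) + g r   ≡⟨ ∑-⊑-split b (g ∘ rank) ⟨
      ∑[ a < n ] (𝟙 (does (a ⊑? b)) * g (rank a))         ≡⟨ ∑-⊑ b (g ∘ rank) ⟩
      ∑ˢ r (g ∘ rank ∘ from b)                           ≡⟨ ∑ˢ-cong r (λ T → cong g (rank-from b T)) ⟩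
      ∑ˢ r (g ∘ ∣_∣)                                     ≡⟨ ∑ˢ-size r g ⟩
      S + binomial r r * g r                              ≡⟨ cong (λ c → S + c * g r) (binomial-diag r) ⟩
      S + 1 * g r                                         ≡⟨ cong (_+_ S) (ℕ.*-identityˡ (g r)) ⟩
      S + g r                                             ∎)
      where
      r = rank b
      S = Σ< r (λ m → binomial r m * g m)

    open Walks _⊏?_

    chainsTo : ℕ → Fin n → ℕ
    chainsTo zero    b = 𝟙 (does (b ≟ᶠ ⊥))
    chainsTo (suc k) = backward (chainsTo k)

    chainsTo≡surjections : ∀ k b → chainsTo k b ≡ surjections (rank b) k
    chainsTo≡surjections zero b with rank b in rank≡
    ... | zero  = cong 𝟙 (dec-true (b ≟ᶠ ⊥) (rank≡0⇒≡⊥ b rank≡))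
    ... | suc _ = cong 𝟙 (dec-false (b ≟ᶠ ⊥)
      (λ b≡⊥ → ℕ.0≢1+n (trans (sym rank-⊥) (trans (cong rank (sym b≡⊥)) rank≡))))
    chainsTo≡surjections (suc k) b = trans
      (sum-cong-≗ (λ a → cong (𝟙 (does (a ⊏? b)) *_) (chainsTo≡surjections k a)))
      (∑-⊏ b (λ m → surjections m k))

    chainsFrom : ℕ → Fin n → ℕ
    chainsFrom k a = count (increasing? Δ ∘ (a ∷_)) (allVecs n k)

    chainsFrom-suc : ∀ k a → chainsFrom (suc k) a ≡ forward (chainsFrom k) a
    chainsFrom-suc k a = trans
      (count-concatMap-tabulate (increasing? Δ ∘ (a ∷_)) (λ b → map (b ∷_) (allVecs n k)) (λ b → b))
      (sum-cong-≗ (λ b → trans (count-map (increasing? Δ ∘ (a ∷_)) (b ∷_) (allVecs n k))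
                               (count-×-dec (a ⊏? b) (increasing? Δ ∘ (b ∷_)) (allVecs n k))))

    chainsTo-1 : ∀ a → chainsTo 1 a ≡ 𝟙 (does (⊥ ⊏? a))
    chainsTo-1 a = trans (sum-cong-≗ (λ c → ℕ.*-comm (𝟙 (does (c ⊏? a))) _))
                         (∑-𝟙-≟ ⊥ (λ c → 𝟙 (does (c ⊏? a))))

    fsd-chainsFrom : ∀ j → fsd Δ (suc j) ≡ ∑[ a < n ] (chainsTo 1 a * chainsFrom j a)
    fsd-chainsFrom j = trans
      (count-concatMap-tabulate (isChain? Δ) (λ a → map (a ∷_) (allVecs n j)) (λ a → a))
      (sum-cong-≗ (λ a → trans (count-map (isChain? Δ) (a ∷_) (allVecs n j))
                         (trans (count-×-dec (⊥ ⊏? a) (increasing? Δ ∘ (a ∷_)) (allVecs n j))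
                                (cong (_* chainsFrom j a) (sym (chainsTo-1 a))))))

    ∑-chainsTo-chainsFrom : ∀ j i →
      ∑[ a < n ] (chainsTo i a * chainsFrom j a) ≡ ∑[ a < n ] chainsTo (j + i) a
    ∑-chainsTo-chainsFrom zero    i = sum-cong-≗ (λ a → ℕ.*-identityʳ (chainsTo i a))
    ∑-chainsTo-chainsFrom (suc j) i = begin
      ∑[ a < n ] (chainsTo i a * chainsFrom (suc j) a)
        ≡⟨ sum-cong-≗ (λ a → cong (chainsTo i a *_) (chainsFrom-suc j a)) ⟩
      ∑[ a < n ] (chainsTo i a * forward (chainsFrom j) a)
        ≡⟨ ∑-*-forward (chainsTo i) (chainsFrom j) ⟩
      ∑[ a < n ] (chainsTo (suc i) a * chainsFrom j a)
        ≡⟨ ∑-chainsTo-chainsFrom j (suc i) ⟩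
      ∑[ a < n ] chainsTo (j + suc i) a
        ≡⟨ cong (λ k → ∑[ a < n ] chainsTo k a) (ℕ.+-suc j i) ⟩
      ∑[ a < n ] chainsTo (suc j + i) a ∎

    fsd-surjections : ∀ d → (∀ a → rank a ≤ d) →
                      ∀ j → fsd Δ j ≡ Σ< (suc d) (λ m → fΔ Δ m * surjections m j)
    fsd-surjections d rank≤d zero =
      sym (trans (Σ<-head d _) (cong (_+_ 1) (Σ<-zero d (λ {m} _ → ℕ.*-zeroʳ (fΔ Δ (suc m))))))
    fsd-surjections d rank≤d (suc j) = begin
      fsd Δ (suc j)                                     ≡⟨ fsd-chainsFrom j ⟩
      ∑[ a < n ] (chainsTo 1 a * chainsFrom j a)        ≡⟨ ∑-chainsTo-chainsFrom j 1 ⟩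
      ∑[ a < n ] chainsTo (j + 1) a                     ≡⟨ cong (λ k → ∑[ a < n ] chainsTo k a) (ℕ.+-comm j 1) ⟩
      ∑[ b < n ] chainsTo (suc j) b                     ≡⟨ sum-cong-≗ by-rank ⟩
      ∑[ b < n ] Σ< (suc d) (λ m → e b m * s m)         ≡⟨ ∑-Σ<-comm (suc d) (λ b m → e b m * s m) ⟩
      Σ< (suc d) (λ m → ∑[ b < n ] (e b m * s m))       ≡⟨ Σ<-cong (suc d) (λ {m} _ → *-distribʳ-sum (s m) (e′ m)) ⟨
      Σ< (suc d) (λ m → (∑[ b < n ] e b m) * s m)       ≡⟨ Σ<-cong (suc d) (λ {m} _ → count-rank m) ⟩
      Σ< (suc d) (λ m → fΔ Δ m * s m)                   ∎
      where
      e : Fin n → ℕ → ℕ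
      e b m = 𝟙 (does (rank b ≟ m))
      e′ : ℕ → Fin n → ℕ
      e′ m b = e b m
      s : ℕ → ℕ
      s m = surjections m (suc j)
      by-rank : ∀ b → chainsTo (suc j) b ≡ Σ< (suc d) (λ m → e b m * s m)
      by-rank b = trans (chainsTo≡surjections (suc j) b) (sym (Σ<-𝟙-≟ (suc d) (rank b) s (s≤s (rank≤d b))))
      count-rank : ∀ m → (∑[ b < n ] e b m) * s m ≡ fΔ Δ m * s m
      count-rank zero    = trans (ℕ.*-zeroʳ (∑[ b < n ] e b 0)) (sym (ℕ.*-zeroʳ (fΔ Δ 0)))
      count-rank (suc m) = cong (_* s (suc m)) (sym (count-tabulate (λ b → rank b ≟ suc m) (λ b → b)))

module SubdivisionMatrix where

  open import Data.Nat using (_+_; _∸_)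
  open import Data.Nat.Tactic.RingSolver using (solve-∀)
  open RangeSums ℕ.+-*-commutativeSemiring
  open ≡ using (sym; cong; cong₂)
  open ≡.≡-Reasoning

  -- sdMatrix d k i is the coefficient of tⁱ in P_{d,k}; only the entries with k ≤ d are ever used.
  sdMatrix : ℕ → ℕ → ℕ → ℕ
  sdMatrix zero    zero    zero    = 1
  sdMatrix zero    zero    (suc i) = 0
  sdMatrix zero    (suc k) i       = 0
  sdMatrix (suc d) k       i       =
    Σ< k (λ j → (t· sdMatrix d j) i) + Σ< (suc d ∸ k) (λ l → sdMatrix d (k + l) i)

  sdMatrix-step : ∀ d k i → k ≤ d →
    sdMatrix (suc d) k i + (t· sdMatrix d k) i ≡ sdMatrix (suc d) (suc k) i + sdMatrix d k i
  sdMatrix-step d k i k≤d = begin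
    (A + Σ< (suc d ∸ k) (P ∘ _+_ k)) + T    ≡⟨ cong (λ N → (A + Σ< N (P ∘ _+_ k)) + T) (ℕ.+-∸-assoc 1 k≤d) ⟩
    (A + Σ< (suc (d ∸ k)) (P ∘ _+_ k)) + T  ≡⟨ cong (λ x → (A + x) + T) (Σ<-head (d ∸ k) (P ∘ _+_ k)) ⟩
    (A + (P (k + 0) + B′)) + T               ≡⟨ cong₂ (λ x y → (A + (P x + y)) + T) (ℕ.+-identityʳ k) B′≡B ⟩
    (A + (P k + B)) + T                      ≡⟨ rearrange A (P k) B T ⟩
    ((A + T) + B) + P k                      ∎
    where
    P : ℕ → ℕ
    P j = sdMatrix d j i
    A = Σ< k (λ j → (t· sdMatrix d j) i)
    T = (t· sdMatrix d k) i
    B = Σ< (d ∸ k) (P ∘ _+_ (suc k))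
    B′ = Σ< (d ∸ k) (P ∘ _+_ k ∘ suc)
    B′≡B : B′ ≡ B
    B′≡B = Σ<-cong (d ∸ k) (λ {l} _ → cong P (ℕ.+-suc k l))
    rearrange : ∀ a p b t → (a + (p + b)) + t ≡ ((a + t) + b) + p
    rearrange = solve-∀

  sdMatrix-top : ∀ d i → sdMatrix (suc d) (suc d) i ≡ (t· (λ i → Σ< (suc d) (λ j → sdMatrix d j i))) i
  sdMatrix-top d i = begin
    A + Σ< (d ∸ d) P  ≡⟨ cong (λ N → A + Σ< N P) (ℕ.n∸n≡0 d) ⟩
    A + 0            ≡⟨ ℕ.+-identityʳ A ⟩
    A                ≡⟨ Σ<-t· (suc d) (sdMatrix d) i ⟩
    (t· (λ i → Σ< (suc d) (λ j → sdMatrix d j i))) i ∎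
    where
    A = Σ< (suc d) (λ j → (t· sdMatrix d j) i)
    P : ℕ → ℕ
    P l = sdMatrix d (suc d + l) i

  sdMatrix-diagonal : ∀ d i → i ≤ d → 1 ≤ sdMatrix d i i
  sdMatrix-diagonal zero    zero    _         = ℕ.≤-refl
  sdMatrix-diagonal (suc d) zero    _         = ℕ.≤-trans (sdMatrix-diagonal d 0 z≤n)
    (ℕ.≤-trans (ℕ.m≤m+n _ _) (ℕ.≤-reflexive (sym (Σ<-head d (λ l → sdMatrix d l 0)))))
  sdMatrix-diagonal (suc d) (suc i) (s≤s i≤d) = ℕ.≤-trans (sdMatrix-diagonal d i i≤d)
    (ℕ.≤-trans (ℕ.m≤n+m _ (Σ< i (λ j → (t· sdMatrix d j) (suc i)))) (ℕ.m≤m+n _ _))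

module HVectors where

  open import Data.Nat using (_∸_) renaming (_+_ to _+ℕ_; _*_ to _*ℕ_)
  open import Data.Integer using (-[1+_]; _+_; _*_; _-_)
  import Data.Integer.Properties as ℤ
  open import Data.Integer.Tactic.RingSolver using (solve-∀)
  open RangeSums ℤ.+-*-commutativeSemiring
  module ℕΣ = RangeSums ℕ.+-*-commutativeSemiring
  open ≡ using (refl; sym; trans; cong; cong₂; subst)
  open ≡.≡-Reasoning

  pos-Σ< : ∀ N (g : ℕ → ℕ) → + ℕΣ.Σ< N g ≡ Σ< N (λ j → + g j)
  pos-Σ< zero    g = refl
  pos-Σ< (suc N) g = trans (ℤ.pos-+ (ℕΣ.Σ< N g) (g N)) (cong (_+ + g N) (pos-Σ< N g))

  pos-binomial : ∀ n k → + ℕΣ.binomial n k ≡ binomial n k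
  pos-binomial n       zero    = refl
  pos-binomial zero    (suc k) = refl
  pos-binomial (suc n) (suc k) =
    trans (ℤ.pos-+ (ℕΣ.binomial n k) _) (cong₂ _+_ (pos-binomial n k) (pos-binomial n (suc k)))

  pos-t· : ∀ (p : ℕ → ℕ) i → + (ℕΣ.t· p) i ≡ (t· (λ i → + p i)) i
  pos-t· p zero    = refl
  pos-t· p (suc i) = refl

  Σ<-distrib-minus : ∀ N (g h : ℕ → ℤ) → Σ< N (λ j → g j - h j) ≡ Σ< N g - Σ< N h
  Σ<-distrib-minus zero    g h = refl
  Σ<-distrib-minus (suc N) g h =
    trans (cong (_+ (g N - h N)) (Σ<-distrib-minus N g h)) (interchange (Σ< N g) (Σ< N h) (g N) (h N))
    where
    interchange : ∀ a b c d → (a - b) + (c - d) ≡ (a + c) - (b + d)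
    interchange = solve-∀

  [1-t]·_ : (ℕ → ℤ) → ℕ → ℤ
  ([1-t]· p) i = p i - (t· p) i

  t·-cong : ∀ {p q : ℕ → ℤ} → (∀ i → p i ≡ q i) → ∀ i → (t· p) i ≡ (t· q) i
  t·-cong p≡q zero    = refl
  t·-cong p≡q (suc i) = p≡q i

  [1-t]·-cong : ∀ {p q : ℕ → ℤ} → (∀ i → p i ≡ q i) → ∀ i → ([1-t]· p) i ≡ ([1-t]· q) i
  [1-t]·-cong p≡q i = cong₂ _-_ (p≡q i) (t·-cong p≡q i)

  Σ<-*-[1-t]· : ∀ N (c : ℕ → ℤ) (p : ℕ → ℕ → ℤ) i →
    Σ< N (λ j → c j * ([1-t]· p j) i) ≡ ([1-t]· (λ i → Σ< N (λ j → c j * p j i))) i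
  Σ<-*-[1-t]· N c p i = begin
    Σ< N (λ j → c j * (p j i - (t· p j) i))      ≡⟨ Σ<-cong N (λ {j} _ → *-distribˡ-minus (c j) (p j i) _) ⟩
    Σ< N (λ j → c j * p j i - c j * (t· p j) i)  ≡⟨ Σ<-distrib-minus N _ _ ⟩
    S - Σ< N (λ j → c j * (t· p j) i)            ≡⟨ cong (_-_ S) (Σ<-*-t· N c p i) ⟩
    ([1-t]· (λ i → Σ< N (λ j → c j * p j i))) i ∎
    where
    S = Σ< N (λ j → c j * p j i)
    *-distribˡ-minus : ∀ x y z → x * (y - z) ≡ x * y - x * z
    *-distribˡ-minus = solve-∀

  infix 8 t^_[1-t]^_

  t^_[1-t]^_ : ℕ → ℕ → ℕ → ℤ
  (t^ m [1-t]^ zero) i  = 𝟙 (does (m ≟ i))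
  t^ m [1-t]^ suc k     = [1-t]· (t^ m [1-t]^ k)

  t^-suc : ∀ m k i → (t^ suc m [1-t]^ k) i ≡ (t· (t^ m [1-t]^ k)) i
  t^-suc m zero    zero    = refl
  t^-suc m zero    (suc i) = refl
  t^-suc m (suc k) zero    = cong (_- + 0) (t^-suc m k zero)
  t^-suc m (suc k) (suc i) = cong₂ _-_ (t^-suc m k (suc i)) (t^-suc m k i)

  t^[1-t]^-high : ∀ m k i → m +ℕ k < i → (t^ m [1-t]^ k) i ≡ + 0
  t^[1-t]^-high m zero    i       m+0<i =
    cong 𝟙 (dec-false (m ≟ i) (ℕ.<⇒≢ (subst (_< i) (ℕ.+-identityʳ m) m+0<i)))
  t^[1-t]^-high m (suc k) (suc i) m+1+k<1+i =
    cong₂ _-_ (t^[1-t]^-high m k (suc i) (ℕ.m<n⇒m<1+n m+k<i)) (t^[1-t]^-high m k i m+k<i)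
    where
    m+k<i : m +ℕ k < i
    m+k<i = ℕ.≤-pred (subst (_< suc i) (ℕ.+-suc m k) m+1+k<1+i)

  t^[1-t]^-low : ∀ m k i → i < m → (t^ m [1-t]^ k) i ≡ + 0
  t^[1-t]^-low (suc m) k zero    _         = t^-suc m k zero
  t^[1-t]^-low (suc m) k (suc i) (s≤s i<m) = trans (t^-suc m k (suc i)) (t^[1-t]^-low m k i i<m)

  t^[1-t]^-shift : ∀ m k i → m ≤ i → (t^ m [1-t]^ k) i ≡ (t^ 0 [1-t]^ k) (i ∸ m)
  t^[1-t]^-shift zero    k i       _         = refl
  t^[1-t]^-shift (suc m) k (suc i) (s≤s m≤i) = trans (t^-suc m k (suc i)) (t^[1-t]^-shift m k i m≤i)

  t^0[1-t]^-at-0 : ∀ k → (t^ 0 [1-t]^ k) 0 ≡ + 1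
  t^0[1-t]^-at-0 zero    = refl
  t^0[1-t]^-at-0 (suc k) = trans (ℤ.+-identityʳ _) (t^0[1-t]^-at-0 k)

  binomialSum : ℕ → ℕ → ℕ → ℤ
  binomialSum c N k = Σ< (suc N) (λ m → binomial c m * (t^ m [1-t]^ (N ∸ m)) k)

  binomialSum-suc : ∀ c N k →
    binomialSum (suc c) (suc N) k ≡ binomialSum c (suc N) k + (t· binomialSum c N) k
  binomialSum-suc c N k = begin
    binomialSum (suc c) (suc N) k
      ≡⟨ Σ<-pascal c (suc N) (λ m → (t^ m [1-t]^ (suc N ∸ m)) k) ⟩
    S + Σ< (suc N) (λ m → binomial c m * (t^ suc m [1-t]^ (N ∸ m)) k)
      ≡⟨ cong (_+_ S) (Σ<-cong (suc N) (λ {m} _ → cong (binomial c m *_) (t^-suc m (N ∸ m) k))) ⟩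
    S + Σ< (suc N) (λ m → binomial c m * (t· (t^ m [1-t]^ (N ∸ m))) k)
      ≡⟨ cong (_+_ S) (Σ<-*-t· (suc N) (binomial c) (λ m → t^ m [1-t]^ (N ∸ m)) k) ⟩
    S + (t· binomialSum c N) k ∎
    where
    S = binomialSum c (suc N) k

  binomialSum-[1-t]· : ∀ N k → binomialSum N (suc N) k ≡ ([1-t]· binomialSum N N) k
  binomialSum-[1-t]· N k = begin
    S + binomial N (suc N) * E (suc N) (N ∸ N)
      ≡⟨ cong (λ c → S + c * E (suc N) (N ∸ N)) (binomial-zero (ℕ.n<1+n N)) ⟩
    S + + 0
      ≡⟨ ℤ.+-identityʳ S ⟩
    Σ< (suc N) (λ m → binomial N m * E m (suc N ∸ m))
      ≡⟨ Σ<-cong (suc N) (λ {m} m≤N → cong (λ e → binomial N m * E m e) (ℕ.+-∸-assoc 1 (ℕ.≤-pred m≤N))) ⟩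
    Σ< (suc N) (λ m → binomial N m * ([1-t]· (t^ m [1-t]^ (N ∸ m))) k)
      ≡⟨ Σ<-*-[1-t]· (suc N) (binomial N) (λ m → t^ m [1-t]^ (N ∸ m)) k ⟩
    ([1-t]· binomialSum N N) k ∎
    where
    E : ℕ → ℕ → ℤ
    E m e = (t^ m [1-t]^ e) k
    S = Σ< (suc N) (λ m → binomial N m * E m (suc N ∸ m))

  binomialSum-diag : ∀ N k → binomialSum N N k ≡ (t^ 0 [1-t]^ 0) k
  binomialSum-diag zero    k = trans (ℤ.+-identityˡ _) (ℤ.*-identityˡ _)
  binomialSum-diag (suc N) k = begin
    binomialSum (suc N) (suc N) k    ≡⟨ binomialSum-suc N N k ⟩
    binomialSum N (suc N) k + (t· B) k ≡⟨ cong (_+ (t· B) k) (binomialSum-[1-t]· N k) ⟩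
    (B k - (t· B) k) + (t· B) k        ≡⟨ cancel (B k) ((t· B) k) ⟩
    B k                              ≡⟨ binomialSum-diag N k ⟩
    (t^ 0 [1-t]^ 0) k                ∎
    where
    B = binomialSum N N
    cancel : ∀ x y → (x - y) + y ≡ x
    cancel = solve-∀

  binomialSum-geometric : ∀ N k → k ≤ N → binomialSum (suc N) N k ≡ + 1
  binomialSum-geometric zero    zero    _         = refl
  binomialSum-geometric (suc N) zero    _         =
    trans (binomialSum-suc (suc N) N 0) (trans (ℤ.+-identityʳ _) (binomialSum-diag (suc N) 0))
  binomialSum-geometric (suc N) (suc k) (s≤s k≤N) = begin
    binomialSum (suc (suc N)) (suc N) (suc k)  ≡⟨ binomialSum-suc (suc N) N (suc k) ⟩
    binomialSum (suc N) (suc N) (suc k) + G    ≡⟨ cong (_+ G) (binomialSum-diag (suc N) (suc k)) ⟩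
    + 0 + G                                    ≡⟨ ℤ.+-identityˡ G ⟩
    G                                          ≡⟨ binomialSum-geometric N k k≤N ⟩
    + 1                                        ∎
    where
    G = binomialSum (suc N) N k

  coeff-⊕ : ∀ p q k → coeff (p ⊕ q) k ≡ coeff p k + coeff q k
  coeff-⊕ []      q       k       = sym (ℤ.+-identityˡ _)
  coeff-⊕ (a ∷ p) []      k       = sym (ℤ.+-identityʳ _)
  coeff-⊕ (a ∷ p) (b ∷ q) zero    = refl
  coeff-⊕ (a ∷ p) (b ∷ q) (suc k) = coeff-⊕ p q k

  coeff-scale : ∀ c p k → coeff (scale c p) k ≡ c * coeff p k
  coeff-scale c []      k       = sym (ℤ.*-zeroʳ c)
  coeff-scale c (a ∷ p) zero    = refl
  coeff-scale c (a ∷ p) (suc k) = coeff-scale c p k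

  coeff-Σ≤ : ∀ d (g : ℕ → Poly) k → coeff (Σ≤ d g) k ≡ Σ< (suc d) (λ j → coeff (g j) k)
  coeff-Σ≤ zero    g k = sym (ℤ.+-identityˡ _)
  coeff-Σ≤ (suc d) g k =
    trans (coeff-⊕ (Σ≤ d g) (g (suc d)) k) (cong (_+ coeff (g (suc d)) k) (coeff-Σ≤ d g k))

  coeff-0∷ : ∀ p k → coeff (+ 0 ∷ p) k ≡ (t· coeff p) k
  coeff-0∷ p zero    = refl
  coeff-0∷ p (suc k) = refl

  coeff-∷-⊗ : ∀ a p q k → coeff ((a ∷ p) ⊗ q) k ≡ a * coeff q k + (t· coeff (p ⊗ q)) k
  coeff-∷-⊗ a p q k = trans (coeff-⊕ (scale a q) _ k) (cong₂ _+_ (coeff-scale a q k) (coeff-0∷ (p ⊗ q) k))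

  coeff-t-1⊗ : ∀ q k → coeff (t-1 ⊗ q) k ≡ (t· coeff q) k - coeff q k
  coeff-t-1⊗ q k = begin
    coeff (t-1 ⊗ q) k                                   ≡⟨ coeff-∷-⊗ -[1+ 0 ] (+ 1 ∷ []) q k ⟩
    -[1+ 0 ] * coeff q k + (t· coeff ((+ 1 ∷ []) ⊗ q)) k ≡⟨ cong (_+_ (-[1+ 0 ] * coeff q k)) (t·-cong unit-⊗ k) ⟩
    -[1+ 0 ] * coeff q k + (t· coeff q) k               ≡⟨ swap (coeff q k) ((t· coeff q) k) ⟩
    (t· coeff q) k - coeff q k                          ∎
    where
    unit-⊗ : ∀ k → coeff ((+ 1 ∷ []) ⊗ q) k ≡ coeff q k
    unit-⊗ k = trans (coeff-∷-⊗ (+ 1) [] q k)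
      (trans (cong (_+_ (+ 1 * coeff q k)) (t·-of-0 k)) (trans (ℤ.+-identityʳ _) (ℤ.*-identityˡ _)))
      where
      t·-of-0 : ∀ k → (t· coeff []) k ≡ + 0
      t·-of-0 zero    = refl
      t·-of-0 (suc k) = refl
    swap : ∀ x y → -[1+ 0 ] * x + y ≡ y - x
    swap = solve-∀

  coeff-[t-1]^-high : ∀ n k → n < k → coeff (t-1 ^ᵖ n) k ≡ + 0
  coeff-[t-1]^-high zero    (suc k) _         = refl
  coeff-[t-1]^-high (suc n) (suc k) (s≤s n<k) = trans (coeff-t-1⊗ (t-1 ^ᵖ n) (suc k))
    (cong₂ _-_ (coeff-[t-1]^-high n k n<k) (coeff-[t-1]^-high n (suc k) (ℕ.m<n⇒m<1+n n<k)))

  coeff-[t-1]^-reverse : ∀ n l → l ≤ n → coeff (t-1 ^ᵖ n) (n ∸ l) ≡ (t^ 0 [1-t]^ n) l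
  coeff-[t-1]^-reverse zero    zero    _ = refl
  coeff-[t-1]^-reverse (suc n) zero    _ = trans (coeff-t-1⊗ (t-1 ^ᵖ n) (suc n))
    (cong₂ _-_ (coeff-[t-1]^-reverse n zero z≤n) (coeff-[t-1]^-high n (suc n) (ℕ.n<1+n n)))
  coeff-[t-1]^-reverse (suc n) (suc l) (s≤s l≤n) = trans (coeff-t-1⊗ (t-1 ^ᵖ n) (n ∸ l))
    (cong₂ _-_ (shifted (ℕ.m≤n⇒m<n∨m≡n l≤n)) (coeff-[t-1]^-reverse n l l≤n))
    where
    shifted : l < n ⊎ l ≡ n → (t· coeff (t-1 ^ᵖ n)) (n ∸ l) ≡ (t^ 0 [1-t]^ n) (suc l)
    shifted (inj₁ l<n)  = trans (cong (t· coeff (t-1 ^ᵖ n)) (ℕ.+-∸-assoc 1 l<n))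
                                (coeff-[t-1]^-reverse n (suc l) l<n)
    shifted (inj₂ refl) = trans (cong (t· coeff (t-1 ^ᵖ l)) (ℕ.n∸n≡0 l))
                                (sym (t^[1-t]^-high 0 l (suc l) (ℕ.n<1+n l)))

  coeff-[t-1]^-basis : ∀ d j i → i ≤ d → j ≤ d →
                       coeff (t-1 ^ᵖ (d ∸ j)) (d ∸ i) ≡ (t^ j [1-t]^ (d ∸ j)) i
  coeff-[t-1]^-basis d j i i≤d j≤d with ℕ.<-≤-connex i j
  ... | inj₁ i<j = trans (coeff-[t-1]^-high (d ∸ j) (d ∸ i) (ℕ.∸-monoʳ-< i<j j≤d))
                         (sym (t^[1-t]^-low j (d ∸ j) i i<j))
  ... | inj₂ j≤i = begin
    coeff (t-1 ^ᵖ (d ∸ j)) (d ∸ i)              ≡⟨ cong (coeff (t-1 ^ᵖ (d ∸ j))) d∸i≡ ⟩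
    coeff (t-1 ^ᵖ (d ∸ j)) ((d ∸ j) ∸ (i ∸ j))  ≡⟨ coeff-[t-1]^-reverse _ (i ∸ j) (ℕ.∸-monoˡ-≤ j i≤d) ⟩
    (t^ 0 [1-t]^ (d ∸ j)) (i ∸ j)               ≡⟨ t^[1-t]^-shift j (d ∸ j) i j≤i ⟨
    (t^ j [1-t]^ (d ∸ j)) i                     ∎
    where
    d∸i≡ : d ∸ i ≡ (d ∸ j) ∸ (i ∸ j)
    d∸i≡ = sym (trans (ℕ.∸-+-assoc d j (i ∸ j)) (cong (d ∸_) (ℕ.m+[n∸m]≡n j≤i)))

  hVec-basis : ∀ d f i → i ≤ d → hVec d f i ≡ Σ< (suc d) (λ j → + f j * (t^ j [1-t]^ (d ∸ j)) i)
  hVec-basis d f i i≤d = trans (coeff-Σ≤ d _ (d ∸ i)) (Σ<-cong (suc d) (λ {j} j≤d →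
    trans (coeff-scale (+ f j) (t-1 ^ᵖ (d ∸ j)) (d ∸ i))
          (cong (+ f j *_) (coeff-[t-1]^-basis d j i i≤d (ℕ.≤-pred j≤d)))))

  hVec-zero : ∀ d f → hVec d f 0 ≡ + f 0
  hVec-zero d f = begin
    hVec d f 0                                           ≡⟨ hVec-basis d f 0 z≤n ⟩
    Σ< (suc d) (λ j → + f j * (t^ j [1-t]^ (d ∸ j)) 0)   ≡⟨ Σ<-head d _ ⟩
    + f 0 * (t^ 0 [1-t]^ d) 0 + Σ< d higher              ≡⟨ cong₂ _+_ (cong (+ f 0 *_) (t^0[1-t]^-at-0 d))
                                                                         (Σ<-zero d higher≡0) ⟩
    + f 0 * + 1 + + 0                                    ≡⟨ trans (ℤ.+-identityʳ _) (ℤ.*-identityʳ _) ⟩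
    + f 0                                                ∎
    where
    higher : ℕ → ℤ
    higher j = + f (suc j) * (t^ suc j [1-t]^ (d ∸ suc j)) 0
    higher≡0 : ∀ {j} → j < d → higher j ≡ + 0
    higher≡0 {j} _ = trans (cong (+ f (suc j) *_) (t^[1-t]^-low (suc j) (d ∸ suc j) 0 (s≤s z≤n)))
                           (ℤ.*-zeroʳ (+ f (suc j)))

  Σ<-summation-by-parts : ∀ N (c Q : ℕ → ℤ) →
    Σ< (suc N) (λ k → ([1-t]· c) k * Q k) ≡ Σ< N (λ k → c k * (Q k - Q (suc k))) + c N * Q N
  Σ<-summation-by-parts zero    c Q = cong (λ x → + 0 + x * Q 0) (ℤ.+-identityʳ (c 0))
  Σ<-summation-by-parts (suc N) c Q =
    trans (cong (_+ (c (suc N) - c N) * Q (suc N)) (Σ<-summation-by-parts N c Q))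
          (regroup (Σ< N (λ k → c k * (Q k - Q (suc k)))) (c N) (c (suc N)) (Q N) (Q (suc N)))
    where
    regroup : ∀ S a b q r → (S + a * q) + (b - a) * r ≡ (S + a * (q - r)) + b * r
    regroup = solve-∀

  open FaceCounting using (surjections; surjections-zero)
  open SubdivisionMatrix

  sdMatrix-difference : ∀ d k i → k ≤ d →
    + sdMatrix (suc d) k i - + sdMatrix (suc d) (suc k) i ≡ ([1-t]· (λ i → + sdMatrix d k i)) i
  sdMatrix-difference d k i k≤d = move (+ a) (+ b) (+ sdMatrix d k i) ((t· (λ i → + sdMatrix d k i)) i) (begin
    + a + (t· (λ i → + sdMatrix d k i)) i   ≡⟨ cong (_+_ (+ a)) (pos-t· (sdMatrix d k) i) ⟨
    + a + + (ℕΣ.t· sdMatrix d k) i          ≡⟨ ℤ.pos-+ a _ ⟨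
    + (a +ℕ (ℕΣ.t· sdMatrix d k) i)         ≡⟨ cong +_ (sdMatrix-step d k i k≤d) ⟩
    + (b +ℕ sdMatrix d k i)                 ≡⟨ ℤ.pos-+ b _ ⟩
    + b + + sdMatrix d k i                  ∎)
    where
    a = sdMatrix (suc d) k i
    b = sdMatrix (suc d) (suc k) i
    move : ∀ a b c x → a + x ≡ b + c → a - b ≡ c - x
    move a b c x e = trans (add x a b) (trans (cong (_- (b + x)) e) (cancel b c x))
      where
      add : ∀ x a b → a - b ≡ (a + x) - (b + x)
      add = solve-∀
      cancel : ∀ b c x → (b + c) - (b + x) ≡ c - x
      cancel = solve-∀

  sdBasis : ℕ → ℕ → ℕ → ℤ
  sdBasis d m i = Σ< (suc d) (λ j → + surjections m j * (t^ j [1-t]^ (d ∸ j)) i)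

  sdMatrixBasis : ℕ → ℕ → ℕ → ℤ
  sdMatrixBasis d m i = Σ< (suc d) (λ k → (t^ m [1-t]^ (d ∸ m)) k * + sdMatrix d k i)

  sdBasis-[1-t]· : ∀ d m i → m ≤ d → sdBasis (suc d) m i ≡ ([1-t]· sdBasis d m) i
  sdBasis-[1-t]· d m i m≤d = begin
    S + s (suc d) * E (suc d) (d ∸ d)
      ≡⟨ cong (λ x → S + + x * E (suc d) (d ∸ d)) (surjections-zero m (suc d) (s≤s m≤d)) ⟩
    S + + 0
      ≡⟨ ℤ.+-identityʳ S ⟩
    Σ< (suc d) (λ j → s j * E j (suc d ∸ j))
      ≡⟨ Σ<-cong (suc d) (λ {j} j≤d → cong (λ e → s j * E j e) (ℕ.+-∸-assoc 1 (ℕ.≤-pred j≤d))) ⟩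
    Σ< (suc d) (λ j → s j * ([1-t]· (t^ j [1-t]^ (d ∸ j))) i)
      ≡⟨ Σ<-*-[1-t]· (suc d) s (λ j → t^ j [1-t]^ (d ∸ j)) i ⟩
    ([1-t]· sdBasis d m) i ∎
    where
    s : ℕ → ℤ
    s j = + surjections m j
    E : ℕ → ℕ → ℤ
    E j e = (t^ j [1-t]^ e) i
    S = Σ< (suc d) (λ j → s j * E j (suc d ∸ j))

  sdMatrixBasis-[1-t]· : ∀ d m i → m ≤ d → sdMatrixBasis (suc d) m i ≡ ([1-t]· sdMatrixBasis d m) i
  sdMatrixBasis-[1-t]· d m i m≤d = begin
    Σ< (suc (suc d)) (λ k → (t^ m [1-t]^ (suc d ∸ m)) k * Q k)
      ≡⟨ cong (λ e → Σ< (suc (suc d)) (λ k → (t^ m [1-t]^ e) k * Q k)) (ℕ.+-∸-assoc 1 m≤d) ⟩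
    Σ< (suc (suc d)) (λ k → ([1-t]· c) k * Q k)
      ≡⟨ Σ<-summation-by-parts (suc d) c Q ⟩
    S + c (suc d) * Q (suc d)
      ≡⟨ cong (λ x → S + x * Q (suc d)) (t^[1-t]^-high m (d ∸ m) (suc d) (s≤s (ℕ.≤-reflexive m+[d∸m]≡d))) ⟩
    S + + 0
      ≡⟨ ℤ.+-identityʳ S ⟩
    S
      ≡⟨ Σ<-cong (suc d) (λ {k} k≤d → cong (c k *_) (sdMatrix-difference d k i (ℕ.≤-pred k≤d))) ⟩
    Σ< (suc d) (λ k → c k * ([1-t]· (λ i → + sdMatrix d k i)) i)
      ≡⟨ Σ<-*-[1-t]· (suc d) c (λ k i → + sdMatrix d k i) i ⟩
    ([1-t]· sdMatrixBasis d m) i ∎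
    where
    c : ℕ → ℤ
    c = t^ m [1-t]^ (d ∸ m)
    Q : ℕ → ℤ
    Q k = + sdMatrix (suc d) k i
    S = Σ< (suc d) (λ k → c k * (Q k - Q (suc k)))
    m+[d∸m]≡d = ℕ.m+[n∸m]≡n m≤d

  sdMatrixBasis-top : ∀ d i → sdMatrixBasis (suc d) (suc d) i ≡ + sdMatrix (suc d) (suc d) i
  sdMatrixBasis-top d i = begin
    Σ< (suc (suc d)) (λ k → (t^ suc d [1-t]^ (d ∸ d)) k * + sdMatrix (suc d) k i)
      ≡⟨ cong (λ e → Σ< (suc (suc d)) (λ k → (t^ suc d [1-t]^ e) k * + sdMatrix (suc d) k i))
              (ℕ.n∸n≡0 d) ⟩
    Σ< (suc (suc d)) (λ k → 𝟙 (does (suc d ≟ k)) * + sdMatrix (suc d) k i)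
      ≡⟨ Σ<-𝟙-≟ (suc (suc d)) (suc d) (λ k → + sdMatrix (suc d) k i) (ℕ.n<1+n (suc d)) ⟩
    + sdMatrix (suc d) (suc d) i ∎

  sdBasis-top : ∀ d i → (∀ m → m ≤ d → ∀ i → sdBasis d m i ≡ sdMatrixBasis d m i) →
    sdBasis (suc d) (suc d) i ≡ + sdMatrix (suc d) (suc d) i
  sdBasis-top d i sdBasis≡ = begin
    sdBasis (suc d) (suc d) i
      ≡⟨ trans (Σ<-head (suc d) _) (ℤ.+-identityˡ _) ⟩
    Σ< (suc d) (λ j → + surjections (suc d) (suc j) * (t^ suc j [1-t]^ (d ∸ j)) i)
      ≡⟨ Σ<-cong (suc d) (λ {j} _ → cong₂ _*_ (pascal-surjections j) (t^-suc j (d ∸ j) i)) ⟩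
    Σ< (suc d) (λ j → Σ< (suc d) (λ m → C m * + surjections m j) * (t· E j) i)
      ≡⟨ Σ<-*-Σ< (suc d) (suc d) C (λ m j → + surjections m j) (λ j → (t· E j) i) ⟨
    Σ< (suc d) (λ m → C m * Σ< (suc d) (λ j → + surjections m j * (t· E j) i))
      ≡⟨ Σ<-cong (suc d) (λ {m} _ → cong (C m *_) (Σ<-*-t· (suc d) (λ j → + surjections m j) E i)) ⟩
    Σ< (suc d) (λ m → C m * (t· sdBasis d m) i)
      ≡⟨ Σ<-*-t· (suc d) C (sdBasis d) i ⟩
    (t· (λ i → Σ< (suc d) (λ m → C m * sdBasis d m i))) i
      ≡⟨ t·-cong column-sums i ⟩
    (t· (λ i → Σ< (suc d) (λ k → + sdMatrix d k i))) i
      ≡⟨ t·-cong (λ i → pos-Σ< (suc d) (λ k → sdMatrix d k i)) i ⟨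
    (t· (λ i → + ℕΣ.Σ< (suc d) (λ k → sdMatrix d k i))) i
      ≡⟨ pos-t· (λ i → ℕΣ.Σ< (suc d) (λ k → sdMatrix d k i)) i ⟨
    + (ℕΣ.t· (λ i → ℕΣ.Σ< (suc d) (λ k → sdMatrix d k i))) i
      ≡⟨ cong +_ (sdMatrix-top d i) ⟨
    + sdMatrix (suc d) (suc d) i ∎
    where
    C : ℕ → ℤ
    C = binomial (suc d)
    E : ℕ → ℕ → ℤ
    E j = t^ j [1-t]^ (d ∸ j)
    pascal-surjections : ∀ j → + surjections (suc d) (suc j) ≡ Σ< (suc d) (λ m → C m * + surjections m j)
    pascal-surjections j = trans (pos-Σ< (suc d) _) (Σ<-cong (suc d) (λ {m} _ →
      trans (ℤ.pos-* (ℕΣ.binomial (suc d) m) _) (cong (_* + surjections m j) (pos-binomial (suc d) m))))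
    column-sums : ∀ i → Σ< (suc d) (λ m → C m * sdBasis d m i) ≡ Σ< (suc d) (λ k → + sdMatrix d k i)
    column-sums i = begin
      Σ< (suc d) (λ m → C m * sdBasis d m i)
        ≡⟨ Σ<-cong (suc d) (λ {m} m≤d → cong (C m *_) (sdBasis≡ m (ℕ.≤-pred m≤d) i)) ⟩
      Σ< (suc d) (λ m → C m * sdMatrixBasis d m i)
        ≡⟨ Σ<-*-Σ< (suc d) (suc d) C (λ m k → (t^ m [1-t]^ (d ∸ m)) k) (λ k → + sdMatrix d k i) ⟩
      Σ< (suc d) (λ k → binomialSum (suc d) d k * + sdMatrix d k i)
        ≡⟨ Σ<-cong (suc d) (λ {k} k≤d → cong (_* + sdMatrix d k i) (binomialSum-geometric d k (ℕ.≤-pred k≤d))) ⟩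
      Σ< (suc d) (λ k → + 1 * + sdMatrix d k i)
        ≡⟨ Σ<-cong (suc d) (λ _ → ℤ.*-identityˡ _) ⟩
      Σ< (suc d) (λ k → + sdMatrix d k i) ∎

  sdBasis≡sdMatrixBasis : ∀ d m → m ≤ d → ∀ i → sdBasis d m i ≡ sdMatrixBasis d m i
  sdBasis≡sdMatrixBasis zero    zero z≤n zero    = refl
  sdBasis≡sdMatrixBasis zero    zero z≤n (suc i) = refl
  sdBasis≡sdMatrixBasis (suc d) m m≤1+d i with ℕ.m≤n⇒m<n∨m≡n m≤1+d
  ... | inj₁ (s≤s m≤d) = begin
    sdBasis (suc d) m i               ≡⟨ sdBasis-[1-t]· d m i m≤d ⟩
    ([1-t]· sdBasis d m) i            ≡⟨ [1-t]·-cong (sdBasis≡sdMatrixBasis d m m≤d) i ⟩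
    ([1-t]· sdMatrixBasis d m) i      ≡⟨ sdMatrixBasis-[1-t]· d m i m≤d ⟨
    sdMatrixBasis (suc d) m i         ∎
  ... | inj₂ refl =
    trans (sdBasis-top d i (λ m m≤d → sdBasis≡sdMatrixBasis d m m≤d)) (sym (sdMatrixBasis-top d i))

  hVec-sdMatrix : ∀ d (f g : ℕ → ℕ) →
    (∀ j → g j ≡ ℕΣ.Σ< (suc d) (λ m → f m *ℕ surjections m j)) →
    ∀ i → i ≤ d → hVec d g i ≡ Σ< (suc d) (λ k → hVec d f k * + sdMatrix d k i)
  hVec-sdMatrix d f g g≡ i i≤d = begin
    hVec d g i
      ≡⟨ hVec-basis d g i i≤d ⟩
    Σ< (suc d) (λ j → + g j * E j i)
      ≡⟨ Σ<-cong (suc d) (λ {j} _ → cong (_* E j i) (+g≡ j)) ⟩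
    Σ< (suc d) (λ j → Σ< (suc d) (λ m → + f m * + surjections m j) * E j i)
      ≡⟨ Σ<-*-Σ< (suc d) (suc d) (λ m → + f m) (λ m j → + surjections m j) (λ j → E j i) ⟨
    Σ< (suc d) (λ m → + f m * sdBasis d m i)
      ≡⟨ Σ<-cong (suc d) (λ {m} m≤d → cong (+ f m *_) (sdBasis≡sdMatrixBasis d m (ℕ.≤-pred m≤d) i)) ⟩
    Σ< (suc d) (λ m → + f m * sdMatrixBasis d m i)
      ≡⟨ Σ<-*-Σ< (suc d) (suc d) (λ m → + f m) E (λ k → + sdMatrix d k i) ⟩
    Σ< (suc d) (λ k → Σ< (suc d) (λ m → + f m * E m k) * + sdMatrix d k i)
      ≡⟨ Σ<-cong (suc d) (λ {k} k≤d → cong (_* + sdMatrix d k i) (hVec-basis d f k (ℕ.≤-pred k≤d))) ⟨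
    Σ< (suc d) (λ k → hVec d f k * + sdMatrix d k i) ∎
    where
    E : ℕ → ℕ → ℤ
    E j = t^ j [1-t]^ (d ∸ j)
    +g≡ : ∀ j → + g j ≡ Σ< (suc d) (λ m → + f m * + surjections m j)
    +g≡ j = trans (cong +_ (g≡ j)) (trans (pos-Σ< (suc d) _) (Σ<-cong (suc d) (λ {m} _ → ℤ.pos-* (f m) _)))

  0≤Σ< : ∀ N {g : ℕ → ℤ} → (∀ {k} → k < N → + 0 ≤ℤ g k) → + 0 ≤ℤ Σ< N g
  0≤Σ< zero    _   = ℤ.≤-refl
  0≤Σ< (suc N) 0≤g = ℤ.+-mono-≤ (0≤Σ< N (0≤g ∘ ℕ.m<n⇒m<1+n)) (0≤g (ℕ.n<1+n N))

  ≤-Σ< : ∀ N {g : ℕ → ℤ} {i} → i < N → (∀ {k} → k < N → + 0 ≤ℤ g k) → g i ≤ℤ Σ< N g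
  ≤-Σ< (suc N) {g} {i} i<1+N 0≤g with ℕ.m≤n⇒m<n∨m≡n (ℕ.≤-pred i<1+N)
  ... | inj₁ i<N = ℤ.≤-trans (≤-Σ< N i<N (0≤g ∘ ℕ.m<n⇒m<1+n))
    (ℤ.≤-trans (ℤ.≤-reflexive (sym (ℤ.+-identityʳ (Σ< N g)))) (ℤ.+-monoʳ-≤ (Σ< N g) (0≤g (ℕ.n<1+n N))))
  ... | inj₂ refl = ℤ.≤-trans (ℤ.≤-reflexive (sym (ℤ.+-identityˡ (g i))))
    (ℤ.+-monoˡ-≤ (g i) (0≤Σ< i (0≤g ∘ ℕ.m<n⇒m<1+n)))

  ≤-Σ<-*-diagonal : ∀ N (h : ℕ → ℤ) (M : ℕ → ℕ) {i} → i < N →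
    (∀ {k} → k < N → + 0 ≤ℤ h k) → 1 ≤ M i → h i ≤ℤ Σ< N (λ k → h k * + M k)
  ≤-Σ<-*-diagonal N h M i<N 0≤h 1≤M =
    ℤ.≤-trans (≤-*-pos (M _) (0≤h i<N) 1≤M) (≤-Σ< N i<N (λ k<N → 0≤*-pos (M _) (0≤h k<N)))
    where
    0≤*-pos : ∀ {x} m → + 0 ≤ℤ x → + 0 ≤ℤ x * + m
    0≤*-pos m (+≤+ {n = a} _) = subst (+ 0 ≤ℤ_) (ℤ.pos-* a m) (+≤+ z≤n)
    ≤-*-pos : ∀ {x} m → + 0 ≤ℤ x → 1 ≤ m → x ≤ℤ x * + m
    ≤-*-pos m (+≤+ {n = a} _) 1≤m = subst (+ a ≤ℤ_) (ℤ.pos-* a m)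
      (+≤+ (ℕ.≤-trans (ℕ.≤-reflexive (sym (ℕ.*-identityʳ a))) (ℕ.*-monoʳ-≤ a 1≤m)))

open FaceCounting using (module Faces)
open SubdivisionMatrix using (sdMatrix; sdMatrix-diagonal)
open HVectors using (hVec-sdMatrix; hVec-zero; ≤-Σ<-*-diagonal)
open RangeSums Data.Integer.Properties.+-*-commutativeSemiring using (Σ<)
open Data.Integer.Properties.≤-Reasoning

corollary2p3 : (n d : ℕ) (Δ : BooleanCellComplex n) → HasDim Δ d →
    (∀ i → 1 ≤ i → i ≤ d → + 0 ≤ℤ hVec d (fΔ Δ) i) →
    ∀ i → i ≤ d → hVec d (fΔ Δ) i ≤ℤ hVec d (fsd Δ) i
corollary2p3 n d Δ (rank≤d , _) h≥0 i i≤d = begin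
  h i                                          ≤⟨ ≤-Σ<-*-diagonal (suc d) h (λ k → sdMatrix d k i) (s≤s i≤d)
                                                                  all-h≥0 (sdMatrix-diagonal d i i≤d) ⟩
  Σ< (suc d) (λ k → h k *ℤ + sdMatrix d k i)  ≡⟨ hVec-sdMatrix d (fΔ Δ) (fsd Δ) (fsd-surjections d rank≤d) i i≤d ⟨
  hVec d (fsd Δ) i                             ∎
  where
  open Faces Δ using (fsd-surjections)
  h : ℕ → ℤ
  h = hVec d (fΔ Δ)
  all-h≥0 : ∀ {k} → k < suc d → + 0 ≤ℤ h k
  all-h≥0 {zero}  _         = ≡.subst (+ 0 ≤ℤ_) (≡.sym (hVec-zero d (fΔ Δ))) (+≤+ z≤n)
  all-h≥0 {suc k} (s≤s k<d) = h≥0 (suc k) (s≤s z≤n) k<d
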